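{- Let $A=(a_{ij})$ be a real $m\times n$ matrix with $\operatorname{rank}(A)=r=\min\{m,n\}$. If $A$ is an ASSR matrix and is type-I staircase, then every nontrivial square submatrix of $A$ is an ASSR matrix.
   Context: For $1\le k\le n$, $Q_{k,n}$ is the set of strictly increasing sequences of $k$ natural numbers not greater than $n$; for $\alpha\in Q_{k,m}$, $\beta\in Q_{k,n}$, $A[\alpha|\beta]$ is the $k\times k$ submatrix of $A$ with rows $\alpha_1,\dots,\alpha_k$ and columns $\beta_1,\dots,\beta_k$. An $m\times n$ real matrix $A=(a_{ij})$ is type-I staircase if: (i) $a_{ii}\neq 0$ for all $i\le\min\{m,n\}$; (ii) if $i>j$ and $a_{ij}=0$ then $a_{kl}=0$ for all $k\ge i$, $l\le j$; (iii) if $i<j$ and $a_{ij}=0$ then $a_{kl}=0$ for all $k\le i$, $l\ge j$. With $P_m$ the $m\times m$ backward identity matrix (entries $1$ where $i+j=m+1$, $0$ elsewhere), $A$ is type-II staircase if $P_mA$ is type-I staircase. For a type-I or type-II staircase matrix $A$, a square submatrix $A[\alpha|\beta]$ ($\alpha\in Q_{k,m},\beta\in Q_{k,n}$) is nontrivial if $a_{\alpha_i,\beta_i}\ne 0$ for all $i=1,\dots,k$; its determinant is then a nontrivial minor. A signature is a vector $\varepsilon=(\varepsilon_1,\dots,\varepsilon_r)$ with each $\varepsilon_i=\pm1$. An $m\times n$ matrix $A$ with $\operatorname{rank}(A)=r=\min\{m,n\}$ is ASSR (almost strictly sign regular) with signature $\varepsilon=(\varepsilon_1,\dots,\varepsilon_r)$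 if it is type-I or type-II staircase and every nontrivial minor satisfies $\varepsilon_k\det A[\alpha|\beta]>0$ for $\alpha\in Q_{k,m}$, $\beta\in Q_{k,n}$, $k\le r$. -}

module Defs where

open import Level using (Level; _⊔_)
open import Data.Nat as ℕ using (ℕ; zero; suc; _⊓_)
open import Data.Fin as Fin using (Fin; zero; suc; toℕ; punchIn; opposite)
open import Data.Product using (Σ; ∃; _×_; _,_)
open import Data.Sum using (_⊎_)
open import Data.Sign using (Sign)
open import Relation.Nullary using (¬_)
open import Relation.Binary using (Rel)
open import Relation.Binary.Structures using (IsStrictTotalOrder)
open import Relation.Binary.PropositionalEquality using (_≡_)
open import Algebra.Bundles using (CommutativeRing)

-- The real numbers, axiomatised as a complete ordered field.
-- (agda-stdlib has no reals; every model of this record is isomorphic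
-- to ℝ, so quantifying over all models states the result for ℝ.)

record RealField (c ℓ : Level) : Set (Level.suc (c ⊔ ℓ)) where
  field
    commutativeRing : CommutativeRing c ℓ
  open CommutativeRing commutativeRing public
  field
    _<_                 : Rel Carrier ℓ
    isStrictTotalOrder  : IsStrictTotalOrder _≈_ _<_
    0<1                 : 0# < 1#
    +-mono-<            : ∀ {x y} z → x < y → (x + z) < (y + z)
    *-pos               : ∀ {x y} → 0# < x → 0# < y → 0# < (x * y)
    inverse             : ∀ x → ¬ (x ≈ 0#) → Σ Carrier (λ y → (x * y) ≈ 1#)
    complete            : (P : Carrier → Set c) → Σ Carrier P →
                          Σ Carrier (λ b → ∀ x → P x → (x < b ⊎ x ≈ b)) →
                          Σ Carrier (λ s → (∀ x → P x → (x < s ⊎ x ≈ s)) ×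
                            (∀ b → (∀ x → P x → (x < b ⊎ x ≈ b)) → (s < b ⊎ s ≈ b)))

-- Q_{k,n}: strictly increasing sequences of k elements of {1..n}
-- (here 0-based: elements of Fin n)
Q : ℕ → ℕ → Set
Q k n = Σ (Fin k → Fin n) (λ α → ∀ (i j : Fin k) → i Fin.< j → α i Fin.< α j)

-- signatures ε = (ε_1,…,ε_r), with ε_k stored at index k-1
Signature : ℕ → Set
Signature r = Fin r → Sign

module _ {c ℓ : Level} (ℝ : RealField c ℓ) where
  open RealField ℝ using (Carrier; _≈_; _<_; _+_; _*_; -_; 0#; 1#)

  Matrix : ℕ → ℕ → Set c
  Matrix m n = Fin m → Fin n → Carrier

  sumF : ∀ {k} → (Fin k → Carrier) → Carrier
  sumF {zero}  f = 0#
  sumF {suc k} f = f zero + sumF (λ i → f (suc i))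

  alt : ℕ → Carrier → Carrier
  alt zero    x = x
  alt (suc t) x = - alt t x

  det : ∀ {k} → Matrix k k → Carrier
  det {zero}  A = 1#
  det {suc k} A =
    sumF (λ j → alt (toℕ j) (A zero j * det (λ i l → A (suc i) (punchIn j l))))

  sub : ∀ {m n k} → Matrix m n → Q k m → Q k n → Matrix k k
  sub A (α , _) (β , _) i j = A (α i) (β j)

  TypeI : ∀ {m n} → Matrix m n → Set ℓ
  TypeI {m} {n} A =
    (∀ (i : Fin m) (j : Fin n) → toℕ i ≡ toℕ j → ¬ (A i j ≈ 0#)) ×
    (∀ (i : Fin m) (j : Fin n) → toℕ j ℕ.< toℕ i → A i j ≈ 0# →
       ∀ (k : Fin m) (l : Fin n) → toℕ i ℕ.≤ toℕ k → toℕ l ℕ.≤ toℕ j → A k l ≈ 0#) ×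
    (∀ (i : Fin m) (j : Fin n) → toℕ i ℕ.< toℕ j → A i j ≈ 0# →
       ∀ (k : Fin m) (l : Fin n) → toℕ k ℕ.≤ toℕ i → toℕ j ℕ.≤ toℕ l → A k l ≈ 0#)

  -- P_m A, with P_m the m × m backward identity matrix
  backward : ∀ {m n} → Matrix m n → Matrix m n
  backward A i j = A (opposite i) j

  TypeII : ∀ {m n} → Matrix m n → Set ℓ
  TypeII A = TypeI (backward A)

  Staircase : ∀ {m n} → Matrix m n → Set ℓ
  Staircase A = TypeI A ⊎ TypeII A

  Nontrivial : ∀ {m n k} → Matrix m n → Q k m → Q k n → Set ℓ
  Nontrivial {k = k} A (α , _) (β , _) = ∀ (i : Fin k) → ¬ (A (α i) (β i) ≈ 0#)

  HasRank : ∀ {m n} → Matrix m n → ℕ → Set ℓ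
  HasRank {m} {n} A r =
    Σ (Q r m) (λ α → Σ (Q r n) (λ β → ¬ (det (sub A α β) ≈ 0#))) ×
    (∀ k → r ℕ.< k → (α : Q k m) (β : Q k n) → det (sub A α β) ≈ 0#)

  _⊙_ : Sign → Carrier → Carrier
  Sign.+ ⊙ x = x
  Sign.- ⊙ x = - x

  ASSR : ∀ {m n} → Matrix m n → Signature (m ⊓ n) → Set ℓ
  ASSR {m} {n} A ε =
    HasRank A (m ⊓ n) × Staircase A ×
    (∀ (k : Fin (m ⊓ n)) (α : Q (suc (toℕ k)) m) (β : Q (suc (toℕ k)) n) →
       Nontrivial A α β → 0# < (ε k ⊙ det (sub A α β)))

{-# OPTIONS --safe #-}
module Submission where

open import Defs
open import Level using (Level)
open import Data.Nat using (ℕ; _≤_; _⊓_)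
open import Data.Product using (Σ)

open import Data.Nat as ℕ using (suc; s≤s)
open import Data.Nat.Properties
  using (≤-refl; <⇒≤; <⇒≱; <-irrefl; ≮⇒≥; <-cmp; m≤n⇒m<n∨m≡n; ⊓-glb; ⊓-mono-≤; ⊓-idem)
open import Data.Fin as Fin using (Fin; toℕ; fromℕ<; inject≤)
open import Data.Fin.Properties using (toℕ-injective; toℕ-fromℕ<; toℕ-inject≤; pigeonhole)
open import Data.Product using (_,_; _×_; ∃₂; proj₁; proj₂)
open import Data.Sum using (inj₁; inj₂)
open import Data.Sign using (Sign)
open import Relation.Binary.PropositionalEquality using (_≡_; refl; sym; cong; subst)
open import Relation.Binary.Definitions using (tri<; tri≈; tri>)
open import Relation.Binary.Structures using (IsStrictTotalOrder)
open import Relation.Nullary using (¬_; contradiction)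
import Algebra.Properties.Ring as RingProperties

-- Index
-- sequences compose, so the nontrivial minors of B are nontrivial minors of A
-- and carry A's signs; in particular det B ≠ 0, so B has full rank. For the
-- staircase shape, the nonzero diagonal of B forces each zero entry of B to
-- lie on the same side of A's diagonal as of B's, so A's rules for
-- propagating zeros restrict to B.

Q-length≤ : ∀ {k m} → Q k m → k ≤ m
Q-length≤ (α , increasing) = ≮⇒≥ λ m<k → no-collision (pigeonhole m<k α)
  where
  no-collision : ¬ ∃₂ λ i j → i Fin.< j × α i ≡ α j
  no-collision (i , j , i<j , αi≡αj) = <-irrefl (cong toℕ αi≡αj) (increasing i j i<j)

Q-monotone : ∀ {k m} (α : Q k m) {i j : Fin k} →
             toℕ i ≤ toℕ j → toℕ (proj₁ α i) ≤ toℕ (proj₁ α j)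
Q-monotone (α , increasing) {i} {j} i≤j with m≤n⇒m<n∨m≡n i≤j
... | inj₁ i<j = <⇒≤ (increasing i j i<j)
... | inj₂ i≡j with toℕ-injective {i = i} {j = j} i≡j
...   | refl = ≤-refl

Q-id : ∀ {k} → Q k k
Q-id = (λ i → i) , λ _ _ i<j → i<j

infixr 9 _∘Q_

_∘Q_ : ∀ {j k m} → Q k m → Q j k → Q j m
(α , α-inc) ∘Q (γ , γ-inc) = (λ i → α (γ i)) , λ i j i<j → α-inc (γ i) (γ j) (γ-inc i j i<j)

module _ {c ℓ : Level} (ℝ : RealField c ℓ) where
  open RealField ℝ using (_≈_; _<_; 0#; -‿cong; ring; isStrictTotalOrder)
    renaming (refl to ≈-refl; trans to ≈-trans)
  open IsStrictTotalOrder isStrictTotalOrder using (irrefl; <-respʳ-≈)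
  open RingProperties ring using (-0#≈0#)

  ⊙-pos⇒≉0 : ∀ s {x} → 0# < _⊙_ ℝ s x → ¬ x ≈ 0#
  ⊙-pos⇒≉0 Sign.+ 0<x x≈0 = irrefl ≈-refl (<-respʳ-≈ x≈0 0<x)
  ⊙-pos⇒≉0 Sign.- 0<-x x≈0 = irrefl ≈-refl (<-respʳ-≈ (≈-trans (-‿cong x≈0) -0#≈0#) 0<-x)

  det≉0⇒HasRank : ∀ {k} (B : Matrix ℝ k k) → ¬ det ℝ B ≈ 0# → HasRank ℝ B k
  det≉0⇒HasRank B det≉0 =
    (Q-id , Q-id , det≉0) , λ _ k<k′ α _ → contradiction (Q-length≤ α) (<⇒≱ k<k′)

  module _ {m n} {A : Matrix ℝ m n} where

    TypeI-zero⇒below : TypeI ℝ A → ∀ {p p′ q} → A p q ≈ 0# → ¬ A p′ q ≈ 0# →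
                       toℕ p′ ≤ toℕ p → toℕ q ℕ.< toℕ p
    TypeI-zero⇒below (diagonal , _ , upper) {p} {p′} {q} z nz p′≤p with <-cmp (toℕ q) (toℕ p)
    ... | tri< q<p _ _ = q<p
    ... | tri≈ _ q≡p _ = contradiction z (diagonal p q (sym q≡p))
    ... | tri> _ _ p<q = contradiction (upper p q p<q z p′ q p′≤p ≤-refl) nz

    TypeI-zero⇒above : TypeI ℝ A → ∀ {p q q′} → A p q ≈ 0# → ¬ A p q′ ≈ 0# →
                       toℕ q′ ≤ toℕ q → toℕ p ℕ.< toℕ q
    TypeI-zero⇒above (diagonal , lower , _) {p} {q} {q′} z nz q′≤q with <-cmp (toℕ p) (toℕ q)
    ... | tri< p<q _ _ = p<q
    ... | tri≈ _ p≡q _ = contradiction z (diagonal p q p≡q)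
    ... | tri> _ _ q<p = contradiction (lower p q q<p z p q′ ≤-refl q′≤q) nz

    TypeI-sub : ∀ {k} → TypeI ℝ A → (α : Q k m) (β : Q k n) → Nontrivial ℝ A α β →
                TypeI ℝ (sub ℝ A α β)
    TypeI-sub typeI@(_ , lower , upper) α@(a , _) β@(b , _) nontrivial =
      diagonal′ , lower′ , upper′
      where
      diagonal′ : ∀ i j → toℕ i ≡ toℕ j → ¬ A (a i) (b j) ≈ 0#
      diagonal′ i j i≡j with toℕ-injective {i = i} {j = j} i≡j
      ... | refl = nontrivial i

      lower′ : ∀ i j → toℕ j ℕ.< toℕ i → A (a i) (b j) ≈ 0# →
               ∀ p q → toℕ i ≤ toℕ p → toℕ q ≤ toℕ j → A (a p) (b q) ≈ 0#
      lower′ i j j<i z p q i≤p q≤j =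
        lower (a i) (b j) (TypeI-zero⇒below typeI z (nontrivial j) (Q-monotone α (<⇒≤ j<i)))
              z (a p) (b q) (Q-monotone α i≤p) (Q-monotone β q≤j)

      upper′ : ∀ i j → toℕ i ℕ.< toℕ j → A (a i) (b j) ≈ 0# →
               ∀ p q → toℕ p ≤ toℕ i → toℕ j ≤ toℕ q → A (a p) (b q) ≈ 0#
      upper′ i j i<j z p q p≤i j≤q =
        upper (a i) (b j) (TypeI-zero⇒above typeI z (nontrivial i) (Q-monotone β (<⇒≤ i<j)))
              z (a p) (b q) (Q-monotone α p≤i) (Q-monotone β j≤q)

  module _ {m n} (A : Matrix ℝ m n) (ε : Signature (m ⊓ n)) (assr : ASSR ℝ A ε) where

    ASSR-sign : ∀ (j : Fin (m ⊓ n)) {t} → toℕ j ≡ t →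
                (α : Q (suc t) m) (β : Q (suc t) n) → Nontrivial ℝ A α β →
                0# < _⊙_ ℝ (ε j) (det ℝ (sub ℝ A α β))
    ASSR-sign j refl = proj₂ (proj₂ assr) j

    ASSR-nontrivial-minor≉0 : ∀ {t} (α : Q (suc t) m) (β : Q (suc t) n) →
                              Nontrivial ℝ A α β → ¬ det ℝ (sub ℝ A α β) ≈ 0#
    ASSR-nontrivial-minor≉0 {t} α β nontrivial =
      ⊙-pos⇒≉0 (ε (fromℕ< t<m⊓n))
               (ASSR-sign (fromℕ< t<m⊓n) (toℕ-fromℕ< t<m⊓n) α β nontrivial)
      where
      t<m⊓n : t ℕ.< m ⊓ n
      t<m⊓n = ⊓-glb (Q-length≤ α) (Q-length≤ β)

proposition3p5 : ∀ {c ℓ : Level} (ℝ : RealField c ℓ) (m n : ℕ) (A : Matrix ℝ m n)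
                 (ε : Signature (m ⊓ n)) → ASSR ℝ A ε → TypeI ℝ A →
                 ∀ (k : ℕ) → 1 ≤ k → (α : Q k m) (β : Q k n) → Nontrivial ℝ A α β →
                 Σ (Signature (k ⊓ k)) (λ ε′ → ASSR ℝ (sub ℝ A α β) ε′)
proposition3p5 ℝ m n A ε assr typeI (suc t) (s≤s _) α β nontrivial =
  ε′ , rank , inj₁ (TypeI-sub ℝ typeI α β nontrivial) , signs
  where
  k⊓k≤m⊓n : suc t ⊓ suc t ≤ m ⊓ n
  k⊓k≤m⊓n = ⊓-mono-≤ (Q-length≤ α) (Q-length≤ β)

  ε′ : Signature (suc t ⊓ suc t)
  ε′ i = ε (inject≤ i k⊓k≤m⊓n)

  rank : HasRank ℝ (sub ℝ A α β) (suc t ⊓ suc t)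
  rank = subst (HasRank ℝ (sub ℝ A α β)) (sym (⊓-idem (suc t)))
               (det≉0⇒HasRank ℝ (sub ℝ A α β)
                 (ASSR-nontrivial-minor≉0 ℝ A ε assr α β nontrivial))

  open RealField ℝ using (0#; _<_)

  signs : ∀ i (α′ β′ : Q (suc (toℕ i)) (suc t)) → Nontrivial ℝ (sub ℝ A α β) α′ β′ →
          0# < _⊙_ ℝ (ε′ i) (det ℝ (sub ℝ (sub ℝ A α β) α′ β′))
  signs i α′ β′ =
    ASSR-sign ℝ A ε assr (inject≤ i k⊓k≤m⊓n) (toℕ-inject≤ i k⊓k≤m⊓n) (α ∘Q α′) (β ∘Q β′)
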